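{- Let $\Gamma$ be a proper LDDG with parameters $(v,k,\lambda_1,\lambda_2,m,n)$. Then $2 \leq k \leq v-2$.
   Context: Graphs here are finite, undirected, without multiple edges, but loops are allowed: a vertex may be adjacent to itself. For a vertex $x$, $\Gamma(x)$ is the set of vertices adjacent to $x$ (containing $x$ iff $x$ has a loop), and the degree of $x$ is $|\Gamma(x)|$ (a loop contributes exactly 1). Common neighbours of $x,y$ are the elements of $\Gamma(x)\cap\Gamma(y)$. A $k$-regular graph on $v$ vertices is an LDDG with parameters $(v,k,\lambda_1,\lambda_2,m,n)$ if its vertex set can be partitioned into $m$ classes of size $n$ such that any two distinct vertices of the same class have exactly $\lambda_1$ common neighbours and any two vertices of different classes have exactly $\lambda_2$ common neighbours. It is proper if $m,n\geq 2$ and $\lambda_1\neq\lambda_2$. -}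

module Defs where

open import Data.Nat using (ℕ; zero; suc; _+_; _≤_)
open import Data.Bool using (Bool; true; false; _∧_)
open import Data.Fin using (Fin; zero; suc)
open import Data.Product using (_×_)
open import Relation.Binary.PropositionalEquality using (_≡_; _≢_)
open import Relation.Nullary using (¬_; does)
open import Data.Fin using (_≟_)

count : {v : ℕ} → (Fin v → Bool) → ℕ
count {zero} p = 0
count {suc v} p with p zero
... | true = suc (count (λ i → p (suc i)))
... | false = count (λ i → p (suc i))

-- A finite undirected graph without multiple edges, loops allowed,
-- on vertex set Fin v: symmetric Boolean adjacency relation.
record Graph (v : ℕ) : Set where
  field
    adj : Fin v → Fin v → Bool
    adj-sym : ∀ x y → adj x y ≡ adj y x

open Graph public

-- |Γ(x)| (a loop contributes exactly 1)
degree : {v : ℕ} → Graph v → Fin v → ℕ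
degree G x = count (λ y → adj G x y)

common : {v : ℕ} → Graph v → Fin v → Fin v → ℕ
common G x y = count (λ z → adj G x z ∧ adj G y z)

Regular : {v : ℕ} → Graph v → ℕ → Set
Regular G k = ∀ x → degree G x ≡ k

record IsLDDG {v : ℕ} (G : Graph v) (k λ₁ λ₂ m n : ℕ) : Set where
  field
    regular : Regular G k
    cls : Fin v → Fin m
    classSize : ∀ (c : Fin m) → count (λ x → does (cls x ≟ c)) ≡ n
    sameClass : ∀ x y → x ≢ y → cls x ≡ cls y → common G x y ≡ λ₁
    diffClass : ∀ x y → cls x ≢ cls y → common G x y ≡ λ₂

record IsProperLDDG {v : ℕ} (G : Graph v) (k λ₁ λ₂ m n : ℕ) : Set where
  field
    lddg : IsLDDG G k λ₁ λ₂ m n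
    m≥2 : 2 ≤ m
    n≥2 : 2 ≤ n
    λ₁≢λ₂ : λ₁ ≢ λ₂

{-# OPTIONS --safe #-}
-- If k ≤ 1, two distinct vertices have no common neighbour, since that
-- neighbour would have degree at least 2; so every pair of distinct vertices
-- has 0 common neighbours. If k ≥ v − 1, the same holds in the complement,
-- which is (v − k)-regular, and inclusion–exclusion gives
-- |Γ(x) ∩ Γ(y)| = 2k − v for all x ≠ y. In a proper LDDG both λ₁ and λ₂ are
-- realised by pairs of distinct vertices, so in either case λ₁ = λ₂.
module Submission where

open import Data.Bool using (Bool; true; false; not; _∧_; T)
open import Data.Bool.Properties using (T-∧)
open import Data.Empty using (⊥-elim)
open import Data.Fin using (Fin; zero; suc; _≟_)
open import Data.Fin.Properties using (suc-injective; 0≢1+n)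
open import Data.Nat using (ℕ; zero; suc; _+_; _∸_; _≤_; _<_; s≤s; z<s)
open import Data.Nat.Properties
  using (≤-refl; ≤-trans; <-≤-trans; <⇒≤; ≤-pred; n≤1+n; ≮⇒≥; ≤⇒≯; n≤0⇒n≡0;
         +-comm; +-suc; +-identityʳ; +-cancelʳ-≤; m+n∸m≡n; m≤n+m∸n; module ≤-Reasoning)
open import Data.Product using (_×_; _,_; ∃; ∃₂; map₂)
open import Function using (_∘_)
open import Function.Bundles using (module Equivalence)
open import Relation.Binary.PropositionalEquality
open import Relation.Nullary using (¬_; does; yes; no)

open import Defs

count-suc≤ : ∀ {v} (p : Fin (suc v) → Bool) → count (p ∘ suc) ≤ count p
count-suc≤ p with p zero
... | true = n≤1+n _
... | false = ≤-refl

T⇒0<count : ∀ {v} (p : Fin v → Bool) {x} → T (p x) → 0 < count p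
T⇒0<count {suc v} p {zero} px with p zero
... | true = z<s
T⇒0<count {suc v} p {suc x} px = <-≤-trans (T⇒0<count (p ∘ suc) px) (count-suc≤ p)

T-distinct⇒2≤count : ∀ {v} (p : Fin v → Bool) {x y} →
                     x ≢ y → T (p x) → T (p y) → 2 ≤ count p
T-distinct⇒2≤count {suc v} p {zero} {zero} x≢y px py = ⊥-elim (x≢y refl)
T-distinct⇒2≤count {suc v} p {zero} {suc y} x≢y px py with p zero
... | true = s≤s (T⇒0<count (p ∘ suc) py)
T-distinct⇒2≤count {suc v} p {suc x} {zero} x≢y px py with p zero
... | true = s≤s (T⇒0<count (p ∘ suc) px)
T-distinct⇒2≤count {suc v} p {suc x} {suc y} x≢y px py =
  ≤-trans (T-distinct⇒2≤count (p ∘ suc) (x≢y ∘ cong suc) px py) (count-suc≤ p)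

0<count⇒∃T : ∀ {v} (p : Fin v → Bool) → 0 < count p → ∃ λ x → T (p x)
0<count⇒∃T {suc v} p 0<count with p zero in p0≡true
... | true = zero , subst T (sym p0≡true) _
... | false = let x , px = 0<count⇒∃T (p ∘ suc) 0<count in suc x , px

2≤count⇒T-distinct : ∀ {v} (p : Fin v → Bool) → 2 ≤ count p →
                     ∃₂ λ x y → x ≢ y × T (p x) × T (p y)
2≤count⇒T-distinct {suc v} p 2≤count with p zero in p0≡true
... | true = let y , py = 0<count⇒∃T (p ∘ suc) (≤-pred 2≤count)
             in zero , suc y , 0≢1+n , subst T (sym p0≡true) _ , py
... | false = let x , y , x≢y , px , py = 2≤count⇒T-distinct (p ∘ suc) 2≤count
              in suc x , suc y , x≢y ∘ suc-injective , px , py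

count-complement : ∀ {v} (p : Fin v → Bool) → count p + count (not ∘ p) ≡ v
count-complement {zero} p = refl
count-complement {suc v} p with p zero
... | true = cong suc (count-complement (p ∘ suc))
... | false = trans (+-suc _ _) (cong suc (count-complement (p ∘ suc)))

suc-middle : ∀ a b c → suc (a + b + c) ≡ a + suc b + c
suc-middle a b c = cong (_+ c) (sym (+-suc a b))

count-inclusion-exclusion : ∀ {v} (p q : Fin v → Bool) →
  v + count (λ i → p i ∧ q i) ≡ count p + count q + count (λ i → not (p i) ∧ not (q i))
count-inclusion-exclusion {zero} p q = refl
count-inclusion-exclusion {suc v} p q
  with p zero | q zero | count-inclusion-exclusion (p ∘ suc) (q ∘ suc)
... | true  | true  | IH =
  cong suc (trans (+-suc v _) (trans (cong suc IH) (suc-middle (count (p ∘ suc)) _ _)))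
... | true  | false | IH = cong suc IH
... | false | true  | IH = trans (cong suc IH) (suc-middle (count (p ∘ suc)) _ _)
... | false | false | IH = trans (cong suc IH) (sym (+-suc _ _))

complement : ∀ {v} → Graph v → Graph v
complement G = record
  { adj = λ x y → not (adj G x y)
  ; adj-sym = λ x y → cong not (adj-sym G x y)
  }

common-neighbour⇒2≤degree : ∀ {v} (G : Graph v) {x y w} → x ≢ y →
                            T (adj G x w ∧ adj G y w) → 2 ≤ degree G w
common-neighbour⇒2≤degree G {x} {y} {w} x≢y xw∧yw =
  let xw , yw = Equivalence.to T-∧ xw∧yw
  in T-distinct⇒2≤count (adj G w) x≢y (flip xw) (flip yw)
  where
  flip : ∀ {u} → T (adj G u w) → T (adj G w u)
  flip {u} = subst T (adj-sym G u w)

degree≤1⇒common≡0 : ∀ {v} (G : Graph v) → (∀ w → degree G w ≤ 1) →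
                    ∀ {x y} → x ≢ y → common G x y ≡ 0
degree≤1⇒common≡0 G degree≤1 {x} {y} x≢y = n≤0⇒n≡0 (≮⇒≥ no-common-neighbour)
  where
  no-common-neighbour : ¬ 0 < common G x y
  no-common-neighbour 0<common =
    let w , xw∧yw = 0<count⇒∃T _ 0<common
    in ≤⇒≯ (degree≤1 w) (common-neighbour⇒2≤degree G x≢y xw∧yw)

degree+degree-complement : ∀ {v} (G : Graph v) x → degree G x + degree (complement G) x ≡ v
degree+degree-complement G x = count-complement (adj G x)

common-complement : ∀ {v} (G : Graph v) x y →
  v + common G x y ≡ degree G x + degree G y + common (complement G) x y
common-complement G x y = count-inclusion-exclusion (adj G x) (adj G y)

regular-dense⇒complement-degree≤1 : ∀ {v k} (G : Graph v) → Regular G k → v ≤ suc k →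
                                    ∀ w → degree (complement G) w ≤ 1
regular-dense⇒complement-degree≤1 {v} {k} G regular v≤1+k w = +-cancelʳ-≤ k _ 1 (begin
  degree (complement G) w + k           ≡⟨ +-comm _ k ⟩
  k + degree (complement G) w           ≡⟨ cong (_+ _) (regular w) ⟨
  degree G w + degree (complement G) w  ≡⟨ degree+degree-complement G w ⟩
  v                                     ≤⟨ v≤1+k ⟩
  suc k                                 ∎)
  where open ≤-Reasoning

regular-dense⇒common≡ : ∀ {v k} (G : Graph v) → Regular G k → v ≤ suc k →
                        ∀ {x y} → x ≢ y → common G x y ≡ k + k ∸ v
regular-dense⇒common≡ {v} {k} G regular v≤1+k {x} {y} x≢y = begin
  common G x y
    ≡⟨ m+n∸m≡n v _ ⟨
  v + common G x y ∸ v
    ≡⟨ cong (_∸ v) (common-complement G x y) ⟩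
  degree G x + degree G y + common (complement G) x y ∸ v
    ≡⟨ cong₂ (λ d e → d + e + _ ∸ v) (regular x) (regular y) ⟩
  k + k + common (complement G) x y ∸ v
    ≡⟨ cong (λ c → k + k + c ∸ v) complement-common≡0 ⟩
  k + k + 0 ∸ v
    ≡⟨ cong (_∸ v) (+-identityʳ (k + k)) ⟩
  k + k ∸ v
    ∎
  where
  open ≡-Reasoning
  complement-common≡0 : common (complement G) x y ≡ 0
  complement-common≡0 = degree≤1⇒common≡0 (complement G)
    (regular-dense⇒complement-degree≤1 G regular v≤1+k) x≢y

≟-true⇒≡ : ∀ {m} {c d : Fin m} → T (does (c ≟ d)) → c ≡ d
≟-true⇒≡ {c = c} {d} c≟d with c ≟ d
... | yes c≡d = c≡d
... | no _ = ⊥-elim c≟d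

module _ {v k λ₁ λ₂ m n} {G : Graph v} (L : IsLDDG G k λ₁ λ₂ m n) where
  open IsLDDG L

  class-member : 1 ≤ n → (c : Fin m) → ∃ λ x → cls x ≡ c
  class-member 1≤n c = map₂ ≟-true⇒≡ (0<count⇒∃T _ (subst (1 ≤_) (sym (classSize c)) 1≤n))

  class-pair : 2 ≤ n → (c : Fin m) → ∃₂ λ x y → x ≢ y × cls x ≡ c × cls y ≡ c
  class-pair 2≤n c =
    let x , y , x≢y , x∈c , y∈c = 2≤count⇒T-distinct _ (subst (2 ≤_) (sym (classSize c)) 2≤n)
    in x , y , x≢y , ≟-true⇒≡ x∈c , ≟-true⇒≡ y∈c

  λ₁-realised : 2 ≤ n → Fin m → ∃₂ λ x y → x ≢ y × common G x y ≡ λ₁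
  λ₁-realised 2≤n c =
    let x , y , x≢y , x∈c , y∈c = class-pair 2≤n c
    in x , y , x≢y , sameClass x y x≢y (trans x∈c (sym y∈c))

  λ₂-realised : 1 ≤ n → (c d : Fin m) → c ≢ d → ∃₂ λ x y → x ≢ y × common G x y ≡ λ₂
  λ₂-realised 1≤n c d c≢d =
    let x , x∈c = class-member 1≤n c
        y , y∈d = class-member 1≤n d
        cls-x≢cls-y = λ e → c≢d (trans (sym x∈c) (trans e y∈d))
    in x , y , cls-x≢cls-y ∘ cong cls , diffClass x y cls-x≢cls-y

proper⇒¬common-constant : ∀ {v k λ₁ λ₂ m n c} {G : Graph v} →
                          IsProperLDDG G k λ₁ λ₂ m n →
                          ¬ (∀ {x y} → x ≢ y → common G x y ≡ c)
proper⇒¬common-constant {λ₁ = λ₁} {λ₂} {c = c} {G} P constant with IsProperLDDG.m≥2 P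
... | s≤s (s≤s _) =
  let x , y , x≢y , common≡λ₁ = λ₁-realised lddg n≥2 zero
      x′ , y′ , x′≢y′ , common≡λ₂ = λ₂-realised lddg (<⇒≤ n≥2) zero (suc zero) 0≢1+n
  in λ₁≢λ₂ (begin
    λ₁             ≡⟨ common≡λ₁ ⟨
    common G x y   ≡⟨ constant x≢y ⟩
    c              ≡⟨ constant x′≢y′ ⟨
    common G x′ y′ ≡⟨ common≡λ₂ ⟩
    λ₂             ∎)
  where
  open IsProperLDDG P
  open ≡-Reasoning

proposition3p3 : ∀ {v k λ₁ λ₂ m n : ℕ} (G : Graph v) →
    IsProperLDDG G k λ₁ λ₂ m n → (2 ≤ k) × (k ≤ v ∸ 2)
proposition3p3 {v} {k} G P = 2≤k , k≤v∸2
  where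
  open IsLDDG (IsProperLDDG.lddg P)
  2≤k : 2 ≤ k
  2≤k = ≮⇒≥ λ k<2 → proper⇒¬common-constant P
    (degree≤1⇒common≡0 G (λ w → subst (_≤ 1) (sym (regular w)) (≤-pred k<2)))
  k≤v∸2 : k ≤ v ∸ 2
  k≤v∸2 = ≮⇒≥ λ v∸2<k → proper⇒¬common-constant P
    (regular-dense⇒common≡ G regular (≤-trans (m≤n+m∸n v 2) (s≤s v∸2<k)))
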